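{- (d'Ocagne's identity) Let $k,a,b$ be positive real numbers. For any integers $m\ge n\ge0$, $S_{k,m}^{(a,b)}S_{k,n+1}^{(a,b)}-S_{k,m+1}^{(a,b)}S_{k,n}^{(a,b)}=(-1)^n\{a^2-(k^2+4)b^2\}F_{k,m-n}.$
   Context: The $k$-Fibonacci numbers are $F_{k,0}=0$, $F_{k,1}=1$, $F_{k,n}=kF_{k,n-1}+F_{k,n-2}$. The $k$-FL sequence is $S_{k,0}^{(a,b)}=2b$, $S_{k,1}^{(a,b)}=bk+a$, $S_{k,n}^{(a,b)}=kS_{k,n-1}^{(a,b)}+S_{k,n-2}^{(a,b)}$ for $n\ge2$. -}

module Defs where

open import Level using (Level)
open import Algebra.Bundles using (CommutativeRing)
open import Data.Nat using (ℕ; zero; suc)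

module KFib {c ℓ : Level} (R : CommutativeRing c ℓ) where
  open CommutativeRing R

  F : Carrier → ℕ → Carrier
  F k zero = 0#
  F k (suc zero) = 1#
  F k (suc (suc n)) = k * F k (suc n) + F k n

  S : Carrier → Carrier → Carrier → ℕ → Carrier
  S k a b zero = b + b
  S k a b (suc zero) = b * k + a
  S k a b (suc (suc n)) = k * S k a b (suc n) + S k a b n

  sgn : ℕ → Carrier
  sgn zero = 1#
  sgn (suc n) = - sgn n

-- The identity is an instance of a fact about every sequence s in a
-- commutative ring satisfying the k-Fibonacci recurrence
-- s(n+2) = k s(n+1) + s(n).  Write
--   C s m n = s(m) s(n+1) - s(m+1) s(n)
-- for its Casorati determinant (the determinant of the rows
-- (s m , s (m+1)) and (s n , s (n+1))).  Two row operations give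
--   * shifting both rows:     C s (m+1) (n+1) = - C s m n,
--   * recurrence in the first row: C s (m+2) n = k C s (m+1) n + C s m n.
-- The first yields C s (n+d) n = (-1)^n C s d 0.  By the second,
-- d ↦ C s d 0 is again a k-Fibonacci sequence, and it vanishes at d = 0,
-- so it equals C s 1 0 · F_{k,d}.  Hence
--   C s m n = (-1)^n (s(1)² - s(2) s(0)) F_{k,m-n}      (n ≤ m).
-- For s = S the constant s(1)² - s(2) s(0) is a² - (k² + 4) b².

module Submission where

open import Defs
open import Level using (Level)
open import Algebra.Bundles using (CommutativeRing)
open import Data.Nat using (ℕ; zero; suc; _≤_; _∸_) renaming (_+_ to _+ℕ_)
open import Data.Nat.Properties using (m+[n∸m]≡n)
import Relation.Binary.PropositionalEquality as ≡
import Relation.Binary.Reasoning.Setoid as SetoidReasoning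

module DOcagne {c ℓ : Level} (R : CommutativeRing c ℓ) where
  open CommutativeRing R
  open KFib R
  open SetoidReasoning setoid
  open import Algebra.Properties.Ring ring
    using (-‿distribˡ-*; -‿distribʳ-*)
  open import Algebra.Properties.AbelianGroup +-abelianGroup
    using (⁻¹-∙-comm; ⁻¹-anti-homo‿-)
  open import Algebra.Properties.CommutativeSemigroup +-commutativeSemigroup
    using (interchange)
  open import Algebra.Solver.Ring.NaturalCoefficients.Default commutativeSemiring
    using (solve; _:=_; _:+_; _:*_; con)

  sum-of-differences : ∀ p q r s → (p - q) + (r - s) ≈ (p + r) - (q + s)
  sum-of-differences p q r s = begin
    (p - q) + (r - s)      ≈⟨ interchange p (- q) r (- s) ⟩
    (p + r) + (- q + - s)  ≈⟨ +-congˡ (⁻¹-∙-comm q s) ⟩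
    (p + r) - (q + s)      ∎

  cancel-summand : ∀ p q t → (p + t) - (q + t) ≈ p - q
  cancel-summand p q t = begin
    (p + t) - (q + t)   ≈⟨ sum-of-differences p q t t ⟨
    (p - q) + (t - t)   ≈⟨ +-congˡ (-‿inverseʳ t) ⟩
    (p - q) + 0#        ≈⟨ +-identityʳ (p - q) ⟩
    p - q               ∎

  sgn-suc : ∀ n x → sgn (suc n) * x ≈ - (sgn n * x)
  sgn-suc n x = sym (-‿distribˡ-* (sgn n) x)

  det : Carrier → Carrier → Carrier → Carrier → Carrier
  det x y u v = x * v - y * u

  det-cong : ∀ {x x′ y y′ u u′ v v′} → x ≈ x′ → y ≈ y′ → u ≈ u′ → v ≈ v′ →
             det x y u v ≈ det x′ y′ u′ v′
  det-cong x≈ y≈ u≈ v≈ = +-cong (*-cong x≈ v≈) (-‿cong (*-cong y≈ u≈))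

  det-equal-rows : ∀ x y → det x y x y ≈ 0#
  det-equal-rows x y = begin
    x * y - y * x   ≈⟨ +-congˡ (-‿cong (*-comm y x)) ⟩
    x * y - x * y   ≈⟨ -‿inverseʳ (x * y) ⟩
    0#              ∎

  det-shift : ∀ k x y u v → det y (k * y + x) v (k * v + u) ≈ - det x y u v
  det-shift k x y u v = begin
    y * (k * v + u) - (k * y + x) * v   ≈⟨ +-cong
      (solve 4 (λ k y u v → y :* (k :* v :+ u) := y :* u :+ k :* y :* v) refl k y u v)
      (-‿cong (solve 4 (λ k x y v → (k :* y :+ x) :* v := x :* v :+ k :* y :* v) refl k x y v)) ⟩
    (y * u + k * y * v) - (x * v + k * y * v) ≈⟨ cancel-summand (y * u) (x * v) (k * y * v) ⟩
    y * u - x * v                       ≈⟨ ⁻¹-anti-homo‿- (x * v) (y * u) ⟨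
    - (x * v - y * u)                   ∎

  det-linear : ∀ k x₁ y₁ x₂ y₂ u v →
               det (k * x₁ + x₂) (k * y₁ + y₂) u v ≈ k * det x₁ y₁ u v + det x₂ y₂ u v
  det-linear k x₁ y₁ x₂ y₂ u v = begin
    (k * x₁ + x₂) * v - (k * y₁ + y₂) * u   ≈⟨ +-cong (distribʳ v (k * x₁) x₂)
                                                      (-‿cong (distribʳ u (k * y₁) y₂)) ⟩
    (k * x₁ * v + x₂ * v) - (k * y₁ * u + y₂ * u)
      ≈⟨ sum-of-differences (k * x₁ * v) (k * y₁ * u) (x₂ * v) (y₂ * u) ⟨
    (k * x₁ * v - k * y₁ * u) + det x₂ y₂ u v
      ≈⟨ +-congʳ (+-cong (*-assoc k x₁ v) (-‿cong (*-assoc k y₁ u))) ⟩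
    (k * (x₁ * v) - k * (y₁ * u)) + det x₂ y₂ u v
      ≈⟨ +-congʳ (+-congˡ (-‿distribʳ-* k (y₁ * u))) ⟩
    (k * (x₁ * v) + k * - (y₁ * u)) + det x₂ y₂ u v
      ≈⟨ +-congʳ (distribˡ k (x₁ * v) (- (y₁ * u))) ⟨
    k * det x₁ y₁ u v + det x₂ y₂ u v     ∎

  Recurrent : Carrier → (ℕ → Carrier) → Set ℓ
  Recurrent k s = ∀ n → s (suc (suc n)) ≈ k * s (suc n) + s n

  S-recurrent : ∀ k a b → Recurrent k (S k a b)
  S-recurrent k a b n = refl

  recurrent-from-zero : ∀ {k s} → Recurrent k s → s 0 ≈ 0# → ∀ n → s n ≈ s 1 * F k n
  recurrent-from-zero {k} {s} rec s₀≈0 = go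
    where
    go : ∀ n → s n ≈ s 1 * F k n
    go zero = trans s₀≈0 (sym (zeroʳ (s 1)))
    go (suc zero) = sym (*-identityʳ (s 1))
    go (suc (suc n)) = begin
      s (suc (suc n))                          ≈⟨ rec n ⟩
      k * s (suc n) + s n                      ≈⟨ +-cong (*-congˡ (go (suc n))) (go n) ⟩
      k * (s 1 * F k (suc n)) + s 1 * F k n    ≈⟨ solve 4 (λ k c f₁ f₀ → k :* (c :* f₁) :+ c :* f₀
                                                    := c :* (k :* f₁ :+ f₀)) refl k (s 1) (F k (suc n)) (F k n) ⟩
      s 1 * (k * F k (suc n) + F k n)          ∎

  casorati : (ℕ → Carrier) → ℕ → ℕ → Carrier
  casorati s m n = det (s m) (s (suc m)) (s n) (s (suc n))

  module _ {k : Carrier} {s : ℕ → Carrier} (rec : Recurrent k s) where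

    casorati-shift : ∀ m n → casorati s (suc m) (suc n) ≈ - casorati s m n
    casorati-shift m n = begin
      casorati s (suc m) (suc n)
        ≈⟨ det-cong refl (rec m) refl (rec n) ⟩
      det (s (suc m)) (k * s (suc m) + s m) (s (suc n)) (k * s (suc n) + s n)
        ≈⟨ det-shift k (s m) (s (suc m)) (s n) (s (suc n)) ⟩
      - casorati s m n ∎

    casorati-recurrent : ∀ n → Recurrent k (λ m → casorati s m n)
    casorati-recurrent n m = begin
      casorati s (suc (suc m)) n
        ≈⟨ det-cong (rec m) (rec (suc m)) refl refl ⟩
      det (k * s (suc m) + s m) (k * s (suc (suc m)) + s (suc m)) (s n) (s (suc n))
        ≈⟨ det-linear k (s (suc m)) (s (suc (suc m))) (s m) (s (suc m)) (s n) (s (suc n)) ⟩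
      k * casorati s (suc m) n + casorati s m n ∎

    casorati-sign : ∀ n d → casorati s (n +ℕ d) n ≈ sgn n * casorati s d 0
    casorati-sign zero d = sym (*-identityˡ (casorati s d 0))
    casorati-sign (suc n) d = begin
      casorati s (suc n +ℕ d) (suc n)   ≈⟨ casorati-shift (n +ℕ d) n ⟩
      - casorati s (n +ℕ d) n           ≈⟨ -‿cong (casorati-sign n d) ⟩
      - (sgn n * casorati s d 0)        ≈⟨ sgn-suc n (casorati s d 0) ⟨
      sgn (suc n) * casorati s d 0      ∎

    casorati-column : ∀ d → casorati s d 0 ≈ casorati s 1 0 * F k d
    casorati-column = recurrent-from-zero (casorati-recurrent 0) (det-equal-rows (s 0) (s 1))

    d'Ocagne : ∀ m n → n ≤ m → casorati s m n ≈ sgn n * (casorati s 1 0 * F k (m ∸ n))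
    d'Ocagne m n n≤m = begin
      casorati s m n                      ≡⟨ ≡.cong (λ j → casorati s j n) (≡.sym (m+[n∸m]≡n n≤m)) ⟩
      casorati s (n +ℕ (m ∸ n)) n         ≈⟨ casorati-sign n (m ∸ n) ⟩
      sgn n * casorati s (m ∸ n) 0        ≈⟨ *-congˡ (casorati-column (m ∸ n)) ⟩
      sgn n * (casorati s 1 0 * F k (m ∸ n)) ∎

  S-characteristic : ∀ k a b →
    casorati (S k a b) 1 0 ≈ a * a - (k * k + (1# + 1# + 1# + 1#)) * (b * b)
  S-characteristic k a b = begin
    (b * k + a) * (b * k + a) - (k * (b * k + a) + (b + b)) * (b + b)
      ≈⟨ +-cong
        (solve 3 (λ k a b → (b :* k :+ a) :* (b :* k :+ a)
                   := a :* a :+ (b :* b :* k :* k :+ con 2 :* a :* b :* k)) refl k a b)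
        (-‿cong (solve 3 (λ k a b → (k :* (b :* k :+ a) :+ (b :+ b)) :* (b :+ b)
                   := (k :* k :+ con 4) :* (b :* b) :+ (b :* b :* k :* k :+ con 2 :* a :* b :* k))
                 refl k a b)) ⟩
    (a * a + cross) - ((k * k + (1# + 1# + 1# + 1#)) * (b * b) + cross)
      ≈⟨ cancel-summand (a * a) ((k * k + (1# + 1# + 1# + 1#)) * (b * b)) cross ⟩
    a * a - (k * k + (1# + 1# + 1# + 1#)) * (b * b) ∎
    where
    cross : Carrier
    cross = b * b * k * k + (1# + 1#) * a * b * k

mainTheorem9 : {c ℓ : Level} (R : CommutativeRing c ℓ) →
    let open CommutativeRing R
        open KFib R
    in (k a b : Carrier) (m n : ℕ) → n ≤ m →
       S k a b m * S k a b (suc n) - S k a b (suc m) * S k a b n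
         ≈ sgn n * ((a * a - (k * k + (1# + 1# + 1# + 1#)) * (b * b)) * F k (m ∸ n))
mainTheorem9 R k a b m n n≤m = begin
  casorati (S k a b) m n
    ≈⟨ d'Ocagne (S-recurrent k a b) m n n≤m ⟩
  sgn n * (casorati (S k a b) 1 0 * F k (m ∸ n))
    ≈⟨ *-congˡ (*-congʳ (S-characteristic k a b)) ⟩
  sgn n * ((a * a - (k * k + (1# + 1# + 1# + 1#)) * (b * b)) * F k (m ∸ n)) ∎
  where
  open DOcagne R
  open CommutativeRing R
  open KFib R
  open SetoidReasoning setoid
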